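{- Let $r\ge1$ be an integer and let $B=\mathcal{S}_n$. If $r$ is even, then $B$ is $(2r,r)$-guaranteed; if $r$ is odd, then $B$ is $(2r-1,r)$-guaranteed.
   Context: $\Sigma$ is a finite alphabet with $|\Sigma|>1$, $n\ge1$, $\mathcal{S}_n=\Sigma^n$ with the edit (Levenshtein) distance $\mathrm{edit}$ (minimum number of single-character insertions, deletions, substitutions). $N_n^r(s)=\{t\in\mathcal{S}_n:\mathrm{edit}(s,t)\le r\}$. A subset $B\subset\mathcal{S}_n$ is $(d_1,r)$-guaranteed if $N_n^r(s)\cap N_n^r(t)\cap B\neq\emptyset$ for every pair $s,t\in\mathcal{S}_n$ with $\mathrm{edit}(s,t)\le d_1$. -}

module Defs where

open import Data.Nat using (ℕ; zero; suc; _≤_)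
open import Data.List using (List; []; _∷_; _++_)
open import Data.Vec using (Vec; toList)
open import Data.Product using (Σ; _×_; _,_)

data Edit1 {A : Set} : List A → List A → Set where
  ins : ∀ (u v : List A) (a : A) → Edit1 (u ++ v) (u ++ (a ∷ v))
  del : ∀ (u v : List A) (a : A) → Edit1 (u ++ (a ∷ v)) (u ++ v)
  sub : ∀ (u v : List A) (a b : A) → Edit1 (u ++ (a ∷ v)) (u ++ (b ∷ v))

data EditsIn {A : Set} : ℕ → List A → List A → Set where
  done : ∀ {s} → EditsIn zero s s
  step : ∀ {k s t u} → Edit1 s t → EditsIn k t u → EditsIn (suc k) s u

EditLe : {A : Set} → List A → ℕ → List A → Set
EditLe s r t = Σ ℕ λ k → k ≤ r × EditsIn k s t

-- Strings of S_n = Σ^n over alphabet Σ = Fin q.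
Str : Set → ℕ → Set
Str A n = Vec A n

InBall : {A : Set} {n : ℕ} → ℕ → Str A n → Str A n → Set
InBall r s u = EditLe (toList s) r (toList u)

Guaranteed : {A : Set} (n : ℕ) → (Str A n → Set) → ℕ → ℕ → Set
Guaranteed {A} n B d₁ r =
  ∀ (s t : Str A n) → EditLe (toList s) d₁ (toList t) →
  Σ (Str A n) λ u → InBall r s u × InBall r t u × B u

{-# OPTIONS --safe #-}
-- Turn the given edit path between s and t into an alignment. Since |s| = |t| it has as many
-- insertions as deletions, say i of each, plus m substitutions, with 2i + m ≤ d₁. Cutting the
-- alignment into two parts, each with equally many insertions and deletions, yields a string u of
-- length n in the middle; this is possible within radius r on both sides as soon as
-- 2i + m ≤ 2r and i ≤ 2⌊r/2⌋, and for d₁ = 2r (r even) or d₁ = 2r − 1 (r odd) both hold.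
module Submission where

open import Defs
open import Data.Nat using (ℕ; zero; suc; _+_; _*_; _∸_; _≤_; z≤n; s≤s; s≤s⁻¹; ⌊_/2⌋)
open import Data.Nat.Properties
open import Data.Nat.Divisibility using (_∣_; divides; ∣m∣n⇒∣m+n; ∣-refl)
open import Data.Fin using (Fin)
open import Data.List using (List; []; _∷_; length)
open import Data.Vec using (Vec; toList; fromList)
open import Data.Vec.Properties using (length-toList; toList∘fromList)
open import Data.Unit using (⊤; tt)
open import Data.Empty using (⊥-elim)
open import Data.Product using (Σ; _×_; _,_)
open import Data.Sum using (inj₁; inj₂)
open import Relation.Nullary using (¬_)
open import Relation.Binary.PropositionalEquality
open import Function using (_∘_)

cost : ℕ → ℕ → ℕ → ℕ
cost i d m = i + d + m

cost-sucᵈ : ∀ i d m → cost i (suc d) m ≡ suc (cost i d m)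
cost-sucᵈ i d m = cong (_+ m) (+-suc i d)

cost-sucᵐ : ∀ i d m → cost i d (suc m) ≡ suc (cost i d m)
cost-sucᵐ i d m = +-suc (i + d) m

cost-monoᵈ : ∀ i d m → cost i d m ≤ cost i (suc d) m
cost-monoᵈ i d m = subst (cost i d m ≤_) (sym (cost-sucᵈ i d m)) (n≤1+n _)

cost-monoᵐ : ∀ i d m → cost i d m ≤ cost i d (suc m)
cost-monoᵐ i d m = subst (cost i d m ≤_) (sym (cost-sucᵐ i d m)) (n≤1+n _)

data Split : ℕ → ℕ → ℕ → ℕ → Set where
  split : ∀ {r₁ r₂} i₁ i₂ m₁ m₂ → cost i₁ i₁ m₁ ≤ r₁ → cost i₂ i₂ m₂ ≤ r₂ →
          Split (i₁ + i₂) (m₁ + m₂) r₁ r₂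

cost-suc-suc : ∀ i m → cost (suc i) (suc i) m ≡ suc (suc (cost i i m))
cost-suc-suc i m = cong suc (cost-sucᵈ i i m)

split-changes : ∀ {m r₁ r₂} → m ≤ r₁ + r₂ → Split 0 m r₁ r₂
split-changes {m} {r₁} {r₂} m≤r with ≤-total m r₁
... | inj₁ m≤r₁ = subst (λ m′ → Split 0 m′ r₁ r₂) (+-identityʳ m) (split 0 0 m 0 m≤r₁ z≤n)
... | inj₂ r₁≤m with m≤n⇒∃[o]m+o≡n r₁≤m
... | e , refl = split 0 0 r₁ e ≤-refl (+-cancelˡ-≤ r₁ e r₂ m≤r)

split-sucˡ : ∀ {i m r₁ r₂} → Split i m r₁ r₂ → Split (suc i) m (2 + r₁) r₂
split-sucˡ {r₁ = r₁} (split i₁ i₂ m₁ m₂ b₁ b₂) =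
  split (suc i₁) i₂ m₁ m₂ (subst (_≤ 2 + r₁) (sym (cost-suc-suc i₁ m₁)) (s≤s (s≤s b₁))) b₂

split-sucʳ : ∀ {i m r₁ r₂} → Split i m r₁ r₂ → Split (suc i) m r₁ (2 + r₂)
split-sucʳ {r₁ = r₁} {r₂} (split i₁ i₂ m₁ m₂ b₁ b₂) =
  subst (λ i → Split i (m₁ + m₂) r₁ (2 + r₂)) (+-suc i₁ i₂)
    (split i₁ (suc i₂) m₁ m₂ b₁ (subst (_≤ 2 + r₂) (sym (cost-suc-suc i₂ m₂)) (s≤s (s≤s b₂))))

budget-split : ∀ r₁ r₂ {i m} → i ≤ ⌊ r₁ /2⌋ + ⌊ r₂ /2⌋ → cost i i m ≤ r₁ + r₂ → Split i m r₁ r₂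
budget-split r₁ r₂ {zero} _ m≤r = split-changes m≤r
budget-split (suc (suc r₁)) r₂ {suc i} {m} (s≤s i≤) c≤r =
  split-sucˡ (budget-split r₁ r₂ i≤ (s≤s⁻¹ (s≤s⁻¹ (subst (_≤ 2 + r₁ + r₂) (cost-suc-suc i m) c≤r))))
budget-split r₁ (suc (suc r₂)) {suc i} {m} i≤ c≤r =
  split-sucʳ (budget-split r₁ r₂ (s≤s⁻¹ (subst (suc i ≤_) (+-suc ⌊ r₁ /2⌋ ⌊ r₂ /2⌋) i≤))
    (s≤s⁻¹ (s≤s⁻¹ (subst₂ _≤_ (cost-suc-suc i m) (+-suc-suc r₁ r₂) c≤r))))
  where
  +-suc-suc : ∀ a b → a + suc (suc b) ≡ suc (suc (a + b))
  +-suc-suc a b = trans (+-suc a (suc b)) (cong suc (+-suc a b))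
budget-split zero          zero          {suc i} () _
budget-split zero          (suc zero)    {suc i} () _
budget-split (suc zero)    zero          {suc i} () _
budget-split (suc zero)    (suc zero)    {suc i} () _

half-≤ : ∀ {i j} → i + i ≤ suc (j + j) → i ≤ j
half-≤ {i} {j} le = subst₂ _≤_ (sym (n≡⌊n+n/2⌋ i)) (sym (n≡⌈n+n/2⌉ j)) (⌊n/2⌋-mono le)

2*n≡n+n : ∀ n → 2 * n ≡ n + n
2*n≡n+n n = cong (n +_) (+-identityʳ n)

2*[1+n]∸1≡1+n+n : ∀ n → 2 * suc n ∸ 1 ≡ suc (n + n)
2*[1+n]∸1≡1+n+n n = trans (cong (n +_) (+-identityʳ (suc n))) (+-suc n n)

even⇒⌊n/2⌋+⌊n/2⌋≡n : ∀ {n} → 2 ∣ n → ⌊ n /2⌋ + ⌊ n /2⌋ ≡ n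
even⇒⌊n/2⌋+⌊n/2⌋≡n (divides h refl) =
  subst (λ n → ⌊ n /2⌋ + ⌊ n /2⌋ ≡ n) (sym (trans (*-comm h 2) (2*n≡n+n h)))
    (sym (cong₂ _+_ (n≡⌊n+n/2⌋ h) (n≡⌊n+n/2⌋ h)))

odd⇒1+⌊n/2⌋+⌊n/2⌋≡n : ∀ n → ¬ 2 ∣ n → suc (⌊ n /2⌋ + ⌊ n /2⌋) ≡ n
odd⇒1+⌊n/2⌋+⌊n/2⌋≡n zero          2∤n = ⊥-elim (2∤n (divides 0 refl))
odd⇒1+⌊n/2⌋+⌊n/2⌋≡n (suc zero)    _   = refl
odd⇒1+⌊n/2⌋+⌊n/2⌋≡n (suc (suc n)) 2∤n =
  cong (suc ∘ suc) (trans (+-suc ⌊ n /2⌋ ⌊ n /2⌋) (odd⇒1+⌊n/2⌋+⌊n/2⌋≡n n (2∤n ∘ ∣m∣n⇒∣m+n ∣-refl)))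

module _ {A : Set} where

  data Align : List A → List A → ℕ → ℕ → ℕ → Set where
    nil    : Align [] [] 0 0 0
    keep   : ∀ {s t i d m} a → Align s t i d m → Align (a ∷ s) (a ∷ t) i d m
    change : ∀ {s t i d m} a b → Align s t i d m → Align (a ∷ s) (b ∷ t) i d (suc m)
    insert : ∀ {s t i d m} b → Align s t i d m → Align s (b ∷ t) (suc i) d m
    delete : ∀ {s t i d m} a → Align s t i d m → Align (a ∷ s) t i (suc d) m

  record Within (s t : List A) (c : ℕ) : Set where
    constructor within
    field
      {insertions deletions changes} : ℕ
      bound : cost insertions deletions changes ≤ c
      alignment : Align s t insertions deletions changes

  exact : ∀ {s t i d m} → Align s t i d m → Within s t (cost i d m)
  exact = within ≤-refl

  within-weaken : ∀ {s t c c′} → c ≤ c′ → Within s t c → Within s t c′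
  within-weaken c≤c′ (within b al) = within (≤-trans b c≤c′) al

  keep-within : ∀ {s t c} a → Within s t c → Within (a ∷ s) (a ∷ t) c
  keep-within a (within b al) = within b (keep a al)

  change-within : ∀ {s t c} a b → Within s t c → Within (a ∷ s) (b ∷ t) (suc c)
  change-within {c = c} a b (within {i} {d} {m} bd al) =
    within (subst (_≤ suc c) (sym (cost-sucᵐ i d m)) (s≤s bd)) (change a b al)

  insert-within : ∀ {s t c} b → Within s t c → Within s (b ∷ t) (suc c)
  insert-within b (within bd al) = within (s≤s bd) (insert b al)

  delete-within : ∀ {s t c} a → Within s t c → Within (a ∷ s) t (suc c)
  delete-within {c = c} a (within {i} {d} {m} bd al) =
    within (subst (_≤ suc c) (sym (cost-sucᵈ i d m)) (s≤s bd)) (delete a al)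

  align-refl : ∀ s → Align s s 0 0 0
  align-refl []      = nil
  align-refl (a ∷ s) = keep a (align-refl s)

  align-sym : ∀ {s t i d m} → Align s t i d m → Align t s d i m
  align-sym nil            = nil
  align-sym (keep a p)     = keep a (align-sym p)
  align-sym (change a b p) = change b a (align-sym p)
  align-sym (insert b p)   = delete b (align-sym p)
  align-sym (delete a p)   = insert a (align-sym p)

  align-length : ∀ {s t i d m} → Align s t i d m → length s + i ≡ length t + d
  align-length nil            = refl
  align-length (keep a p)     = cong suc (align-length p)
  align-length (change a b p) = cong suc (align-length p)
  align-length {s = s} {i = suc i} (insert b p) = trans (+-suc (length s) i) (cong suc (align-length p))
  align-length {t = t} {d = suc d} (delete a p) = trans (cong suc (align-length p)) (sym (+-suc (length t) d))

  data Edit1′ : List A → List A → Set where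
    ins-here : ∀ {v} a → Edit1′ v (a ∷ v)
    del-here : ∀ {v} a → Edit1′ (a ∷ v) v
    sub-here : ∀ {v} a b → Edit1′ (a ∷ v) (b ∷ v)
    under    : ∀ {s x} c → Edit1′ s x → Edit1′ (c ∷ s) (c ∷ x)

  Edit1⇒Edit1′ : ∀ {s x} → Edit1 s x → Edit1′ s x
  Edit1⇒Edit1′ (ins []      v a)   = ins-here a
  Edit1⇒Edit1′ (ins (c ∷ u) v a)   = under c (Edit1⇒Edit1′ (ins u v a))
  Edit1⇒Edit1′ (del []      v a)   = del-here a
  Edit1⇒Edit1′ (del (c ∷ u) v a)   = under c (Edit1⇒Edit1′ (del u v a))
  Edit1⇒Edit1′ (sub []      v a b) = sub-here a b
  Edit1⇒Edit1′ (sub (c ∷ u) v a b) = under c (Edit1⇒Edit1′ (sub u v a b))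

  align-tail : ∀ {a s t i d m} → Align (a ∷ s) t i d m → Within s t (suc (cost i d m))
  align-tail (keep a p) = insert-within a (exact p)
  align-tail {i = i} (change {d = d} {m = m} a b p) =
    within-weaken (s≤s (cost-monoᵐ i d m)) (insert-within b (exact p))
  align-tail (insert b p) = insert-within b (align-tail p)
  align-tail {i = i} (delete {d = d} {m = m} a p) =
    within-weaken (m≤n⇒m≤1+n (cost-monoᵈ i d m)) (exact p)

  align-change-head : ∀ {a s t i d m} b → Align (a ∷ s) t i d m → Within (b ∷ s) t (suc (cost i d m))
  align-change-head b (keep a p) = change-within b a (exact p)
  align-change-head {i = i} b (change {d = d} {m = m} a c p) =
    within-weaken (s≤s (cost-monoᵐ i d m)) (change-within b c (exact p))
  align-change-head b (insert c p) = insert-within c (align-change-head b p)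
  align-change-head {i = i} b (delete {d = d} {m = m} a p) =
    within-weaken (s≤s (cost-monoᵈ i d m)) (delete-within b (exact p))

  edit-then-align : ∀ {s x t i d m} → Edit1′ s x → Align x t i d m → Within s t (suc (cost i d m))
  edit-then-align (ins-here a) p   = align-tail p
  edit-then-align (del-here a) p   = delete-within a (exact p)
  edit-then-align (sub-here a b) p = align-change-head a p
  edit-then-align (under c e) (keep .c p) = keep-within c (edit-then-align e p)
  edit-then-align {i = i} (under c e) (change {d = d} {m = m} .c b p) =
    within-weaken (≤-reflexive (cong suc (sym (cost-sucᵐ i d m)))) (change-within c b (edit-then-align e p))
  edit-then-align (under c e) (insert b p) = insert-within b (edit-then-align (under c e) p)
  edit-then-align {i = i} (under c e) (delete {d = d} {m = m} .c p) =
    within-weaken (≤-reflexive (cong suc (sym (cost-sucᵈ i d m)))) (delete-within c (edit-then-align e p))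

  EditsIn⇒Within : ∀ {k s t} → EditsIn k s t → Within s t k
  EditsIn⇒Within {s = s} done = exact (align-refl s)
  EditsIn⇒Within (step e p) with EditsIn⇒Within p
  ... | within bd al = within-weaken (s≤s bd) (edit-then-align (Edit1⇒Edit1′ e) al)

  EditsIn-cons : ∀ {k} {s t : List A} a → EditsIn k s t → EditsIn k (a ∷ s) (a ∷ t)
  EditsIn-cons a done                      = done
  EditsIn-cons a (step (ins u v b) p)   = step (ins (a ∷ u) v b) (EditsIn-cons a p)
  EditsIn-cons a (step (del u v b) p)   = step (del (a ∷ u) v b) (EditsIn-cons a p)
  EditsIn-cons a (step (sub u v b c) p) = step (sub (a ∷ u) v b c) (EditsIn-cons a p)

  Align⇒EditsIn : ∀ {s t i d m} → Align s t i d m → EditsIn (cost i d m) s t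
  Align⇒EditsIn nil        = done
  Align⇒EditsIn (keep a p) = EditsIn-cons a (Align⇒EditsIn p)
  Align⇒EditsIn {a ∷ s} {b ∷ t} {i} (change {d = d} {m = m} a b p) =
    subst (λ k → EditsIn k (a ∷ s) (b ∷ t)) (sym (cost-sucᵐ i d m))
      (step (sub [] s a b) (EditsIn-cons b (Align⇒EditsIn p)))
  Align⇒EditsIn {s} (insert b p) = step (ins [] s b) (EditsIn-cons b (Align⇒EditsIn p))
  Align⇒EditsIn {a ∷ s} {t} {i} (delete {d = d} {m = m} a p) =
    subst (λ k → EditsIn k (a ∷ s) t) (sym (cost-sucᵈ i d m)) (step (del [] s a) (Align⇒EditsIn p))

  Align⇒EditLe : ∀ {s t i d m r} → cost i d m ≤ r → Align s t i d m → EditLe s r t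
  Align⇒EditLe {i = i} {d} {m} le p = cost i d m , le , Align⇒EditsIn p

  align-split : ∀ {s t i d m} i₁ i₂ d₁ d₂ m₁ m₂ → Align s t i d m →
                i₁ + i₂ ≡ i → d₁ + d₂ ≡ d → m₁ + m₂ ≡ m →
                Σ (List A) λ u → Align s u i₁ d₁ m₁ × Align u t i₂ d₂ m₂
  align-split zero zero zero zero zero zero nil refl refl refl = [] , nil , nil
  align-split i₁ i₂ d₁ d₂ m₁ m₂ (keep a p) eᵢ eᵈ eᵐ with align-split i₁ i₂ d₁ d₂ m₁ m₂ p eᵢ eᵈ eᵐ
  ... | u , p₁ , p₂ = a ∷ u , keep a p₁ , keep a p₂
  align-split i₁ i₂ d₁ d₂ zero m₂ (change a b p) eᵢ eᵈ refl with align-split i₁ i₂ d₁ d₂ zero _ p eᵢ eᵈ refl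
  ... | u , p₁ , p₂ = a ∷ u , keep a p₁ , change a b p₂
  align-split i₁ i₂ d₁ d₂ (suc m₁) m₂ (change a b p) eᵢ eᵈ refl with align-split i₁ i₂ d₁ d₂ m₁ m₂ p eᵢ eᵈ refl
  ... | u , p₁ , p₂ = b ∷ u , change a b p₁ , keep b p₂
  align-split zero i₂ d₁ d₂ m₁ m₂ (insert b p) refl eᵈ eᵐ with align-split zero _ d₁ d₂ m₁ m₂ p refl eᵈ eᵐ
  ... | u , p₁ , p₂ = u , p₁ , insert b p₂
  align-split (suc i₁) i₂ d₁ d₂ m₁ m₂ (insert b p) refl eᵈ eᵐ with align-split i₁ i₂ d₁ d₂ m₁ m₂ p refl eᵈ eᵐ
  ... | u , p₁ , p₂ = b ∷ u , insert b p₁ , keep b p₂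
  align-split i₁ i₂ zero d₂ m₁ m₂ (delete a p) eᵢ refl eᵐ with align-split i₁ i₂ zero _ m₁ m₂ p eᵢ refl eᵐ
  ... | u , p₁ , p₂ = a ∷ u , keep a p₁ , delete a p₂
  align-split i₁ i₂ (suc d₁) d₂ m₁ m₂ (delete a p) eᵢ refl eᵐ with align-split i₁ i₂ d₁ d₂ m₁ m₂ p eᵢ refl eᵐ
  ... | u , p₁ , p₂ = u , delete a p₁ , p₂

  align-balanced : ∀ {s t : List A} {i d m} → length s ≡ length t → Align s t i d m → i ≡ d
  align-balanced {s} {i = i} {d} |s|≡|t| p =
    +-cancelˡ-≡ (length s) i d (trans (align-length p) (cong (_+ d) (sym |s|≡|t|)))

  midpoint : ∀ {s t : List A} {i m r₁ r₂} → Align s t i i m → Split i m r₁ r₂ →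
             Σ (List A) λ u → length u ≡ length s × EditLe s r₁ u × EditLe t r₂ u
  midpoint {s} p (split i₁ i₂ m₁ m₂ b₁ b₂) with align-split i₁ i₂ i₁ i₂ m₁ m₂ p refl refl refl
  ... | u , p₁ , p₂ =
    u , sym (+-cancelʳ-≡ i₁ (length s) (length u) (align-length p₁)) ,
    Align⇒EditLe b₁ p₁ , Align⇒EditLe b₂ (align-sym p₂)

  fromList-sized : ∀ {n} (l : List A) → length l ≡ n → Σ (Vec A n) λ v → toList v ≡ l
  fromList-sized l refl = fromList l , toList∘fromList l

  guaranteed-everywhere : ∀ n {d₁ r} → d₁ ≤ r + r → (∀ i → i + i ≤ d₁ → i ≤ ⌊ r /2⌋ + ⌊ r /2⌋) →
                          Guaranteed {A} n (λ _ → ⊤) d₁ r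
  guaranteed-everywhere n {d₁} {r} d₁≤2r pairs≤ s t (k , k≤d₁ , path) with EditsIn⇒Within path
  ... | within {i} {d} {m} c≤k p with align-balanced (trans (length-toList s) (sym (length-toList t))) p
  ... | refl with midpoint p (budget-split r r (pairs≤ i (≤-trans (m≤m+n (i + i) m) c≤d₁)) (≤-trans c≤d₁ d₁≤2r))
    where
    c≤d₁ : cost i i m ≤ d₁
    c≤d₁ = ≤-trans c≤k k≤d₁
  ... | u , |u|≡n , s→u , t→u with fromList-sized u (trans |u|≡n (length-toList s))
  ... | v , refl = v , s→u , t→u , tt

lemma6 : (q : ℕ) → 2 ≤ q → (n : ℕ) → 1 ≤ n → (r : ℕ) → 1 ≤ r →
    (2 ∣ r → Guaranteed {Fin q} n (λ _ → ⊤) (2 * r) r)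
    × (¬ 2 ∣ r → Guaranteed {Fin q} n (λ _ → ⊤) (2 * r ∸ 1) r)
lemma6 q _ n _ r _ = even , odd
  where
  even : 2 ∣ r → Guaranteed {Fin q} n (λ _ → ⊤) (2 * r) r
  even 2∣r = guaranteed-everywhere n (≤-reflexive (2*n≡n+n r)) λ i i+i≤2r →
    subst (i ≤_) (sym (even⇒⌊n/2⌋+⌊n/2⌋≡n 2∣r))
      (half-≤ (m≤n⇒m≤1+n (subst (i + i ≤_) (2*n≡n+n r) i+i≤2r)))

  odd : ¬ 2 ∣ r → Guaranteed {Fin q} n (λ _ → ⊤) (2 * r ∸ 1) r
  odd 2∤r = guaranteed-everywhere n (≤-trans (m∸n≤m (2 * r) 1) (≤-reflexive (2*n≡n+n r))) λ i i+i≤2r-1 →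
    half-≤ (subst (i + i ≤_) 2r-1≡1+j+j i+i≤2r-1)
    where
    j : ℕ
    j = ⌊ r /2⌋ + ⌊ r /2⌋
    2r-1≡1+j+j : 2 * r ∸ 1 ≡ suc (j + j)
    2r-1≡1+j+j = subst (λ x → 2 * x ∸ 1 ≡ suc (j + j)) (odd⇒1+⌊n/2⌋+⌊n/2⌋≡n r 2∤r) (2*[1+n]∸1≡1+n+n j)
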